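{- Let $A$ be a set with decidable equality, let $p$ be a finite list of pairs of elements of $A$, and let $g=\mathrm{fromFP}(p)$. Let $ats$ be a list enumerating $\mathrm{supp}(g)$ without repetitions and let $R=\mathrm{cycles}_g(|ats|,ats,[])$. Then $\mathrm{fromFP}(\mathrm{toFP}^*(R))=\mathrm{fromFP}(p)$ (as functions), and every element of $A$ occurring in some pair of $\mathrm{toFP}^*(R)$ belongs to $\mathrm{supp}(\mathrm{fromFP}(\mathrm{toFP}^*(R)))$.
   Context: $\mathrm{supp}(h)=\{x\in A\mid h\,x\neq x\}$. The transposition $(x\ y)$ swaps $x,y$ and fixes everything else. $a:\rho$ denotes the sequence with first element $a$ followed by $\rho$; $\rho[c]$ denotes $\rho$ with $c$ appended; $\mathrm{last}(\rho)$ is its last element. $\mathrm{toFP}(a,[])=[]$, $\mathrm{toFP}(a,b:\rho')=(a,b):\mathrm{toFP}(b,\rho')$. $\mathrm{fromFP}([])=\mathrm{id}$, $\mathrm{fromFP}((a,b):as')=(a\ b)\circ\mathrm{fromFP}(as')$ (right-hand function applied first). For a bijection $g$: $\mathrm{cycle}_g(0,a)=[g\,a]$ and $\mathrm{cycle}_g(n+1,a)=\rho$ if $g\,b=a$, else $\rho[g\,b]$, where $\rho=\mathrm{cycle}_g(n,a)$, $b=\mathrm{last}(\rho)$. For a list $R$ of sequences with $\bigcup R$ the set of elements occurring in them: $\mathrm{cycles}_g(n,[],R)=R$; $\mathrm{cycles}_g(n,a:as,R)=\mathrm{cycles}_g(n,as,R)$ if $a\in\bigcup R$, else $\mathrm{cycles}_g(n,as,(a:\mathrm{cycle}_g(n,a)):R)$.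 For a list $R$ whose entries are non-empty sequences $a:\rho$, $\mathrm{toFP}^*(R)$ is the concatenation, in list order, of $\mathrm{toFP}(a,\rho)$ over the entries. -}

module Defs where

open import Level using (Level)
open import Data.Nat using (ℕ; zero; suc)
open import Data.Product using (_×_; _,_)
open import Data.List using (List; []; _∷_; _++_; concatMap)
open import Data.List.NonEmpty as L⁺ using (List⁺; _∷_; [_]; _⁺∷ʳ_; last)
open import Data.List.Relation.Unary.Any using (any?)
open import Relation.Binary.Definitions using (DecidableEquality)
open import Relation.Binary.PropositionalEquality using (_≡_)
open import Relation.Nullary using (¬_; yes; no; does)
open import Data.Bool using (if_then_else_)
open import Function using (id; _∘_)

private variable
  a : Level
  A : Set a

_∈supp_ : A → (A → A) → Set _
x ∈supp h = ¬ (h x ≡ x)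

swap : DecidableEquality A → A → A → A → A
swap _≟_ x y z with z ≟ x
... | yes _ = y
... | no _ with z ≟ y
...   | yes _ = x
...   | no _ = z

toFP : A → List A → List (A × A)
toFP a [] = []
toFP a (b ∷ ρ') = (a , b) ∷ toFP b ρ'

fromFP : DecidableEquality A → List (A × A) → A → A
fromFP _≟_ [] = id
fromFP _≟_ ((a , b) ∷ as') = swap _≟_ a b ∘ fromFP _≟_ as'

cycle : DecidableEquality A → (A → A) → ℕ → A → List⁺ A
cycle _≟_ g zero a = [ g a ]
cycle _≟_ g (suc n) a with cycle _≟_ g n a
... | ρ = if does (g (last ρ) ≟ a) then ρ else (ρ ⁺∷ʳ g (last ρ))

⋃ : List (List⁺ A) → List A
⋃ = concatMap L⁺.toList

cycles : DecidableEquality A → (A → A) → ℕ → List A → List (List⁺ A) → List (List⁺ A)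
cycles _≟_ g n [] R = R
cycles _≟_ g n (x ∷ xs) R =
  if does (any? (x ≟_) (⋃ R))
  then cycles _≟_ g n xs R
  else cycles _≟_ g n xs ((x ∷ L⁺.toList (cycle _≟_ g n x)) ∷ R)

toFP* : List (List⁺ A) → List (A × A)
toFP* = concatMap (λ { (x ∷ ρ) → toFP x ρ })

-- Since g = fromFP p is injective and its support is enumerated by ats, iterating g from a
-- point of the support never repeats a point before returning to the start, and by
-- pigeonhole it returns within |ats| steps: cycle_g(|ats|, x) is the whole g-orbit of x.
-- The orbits collected by cycles_g are pairwise disjoint and cover supp g. Along an orbit
-- x₀ ↦ x₁ ↦ ⋯ ↦ x_k ↦ x₀ the product (x₀ x₁)(x₁ x₂)⋯(x_{k-1} x_k) acts as g and fixes every
-- other point, so the product over all orbits is g. Every pair (x, g x) it uses has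
-- x ≠ g x, so both of its entries are moved.
module Submission where

open import Level using (Level)
open import Data.Nat using (zero; suc; _≤_)
open import Data.Nat.Properties using (+-comm; 1+n≰n)
open import Data.Fin using (Fin; zero; suc)
open import Data.Fin.Properties using (injective⇒≤)
open import Data.Product using (_×_; _,_)
import Data.Product as Product
open import Data.Sum using (_⊎_; inj₁; inj₂)
import Data.Sum as Sum
open import Data.List using (List; []; _∷_; _++_; _∷ʳ_; length; lookup; initLast; _∷ʳ′_)
open import Data.List.Properties using (length-++)
open import Data.List.NonEmpty as L⁺ using (List⁺; _∷_)
open import Data.List.Relation.Unary.Any using (here; there; index; any?)
open import Data.List.Relation.Unary.Any.Properties using (lookup-index)
open import Data.List.Relation.Unary.All as All using (All; []; _∷_)
open import Data.List.Relation.Unary.AllPairs using ([]; _∷_)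
open import Data.List.Relation.Unary.Unique.Propositional using (Unique)
import Data.List.Relation.Unary.Unique.Propositional.Properties as Unique
open import Data.List.Relation.Binary.Disjoint.Propositional using (Disjoint)
open import Data.List.Relation.Binary.Subset.Propositional using (_⊆_)
open import Data.List.Membership.Propositional using (_∈_; _∉_)
open import Data.List.Membership.Propositional.Properties using (∈-lookup; ∈-++⁻; ∈-++⁺ˡ; ∈-++⁺ʳ)
open import Function using (_∘_)
open import Function.Bundles using (_⇔_; Equivalence)
open import Function.Definitions using (Injective)
open import Relation.Binary.Definitions using (DecidableEquality)
open import Relation.Binary.PropositionalEquality
open import Relation.Nullary using (yes; no; contradiction)
open import Relation.Nullary.Decidable using (decidable-stable)
open import Relation.Unary using (Pred)

open import Defs

private variable
  a : Level
  A : Set a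
  P : Pred A a
  f g h k : A → A
  u v x y z : A
  xs ys : List A
  cyc : List⁺ A
  R : List (List⁺ A)

∈supp-resp-≗ : (∀ z → f z ≡ g z) → x ∈supp g → x ∈supp f
∈supp-resp-≗ {x = x} f≗g x∈supp fx≡x = x∈supp (trans (sym (f≗g x)) fx≡x)

length-∷ʳ : ∀ (xs : List A) → length (xs ∷ʳ y) ≡ suc (length xs)
length-∷ʳ xs = trans (length-++ xs) (+-comm (length xs) 1)

Unique-∷ʳ : Unique xs → y ∉ xs → Unique (xs ∷ʳ y)
Unique-∷ʳ xs-unique y∉xs = Unique.++⁺ xs-unique ([] ∷ []) λ { (y∈xs , here refl) → y∉xs y∈xs }

lookup-injective : Unique xs → ∀ {i j} → lookup xs i ≡ lookup xs j → i ≡ j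
lookup-injective {xs = _ ∷ _} _        {zero}  {zero}  _ = refl
lookup-injective {xs = _ ∷ _} (x∉ ∷ _) {zero}  {suc j} e = contradiction e (All.lookup x∉ (∈-lookup j))
lookup-injective {xs = _ ∷ _} (x∉ ∷ _) {suc i} {zero}  e = contradiction (sym e) (All.lookup x∉ (∈-lookup i))
lookup-injective {xs = _ ∷ _} (_ ∷ u)  {suc i} {suc j} e = cong suc (lookup-injective u e)

Unique⇒length≤ : Unique xs → xs ⊆ ys → length xs ≤ length ys
Unique⇒length≤ {xs = xs} {ys = ys} xs-unique xs⊆ys = injective⇒≤ position-injective
  where
  position : Fin (length xs) → Fin (length ys)
  position i = index (xs⊆ys (∈-lookup i))

  position-injective : Injective _≡_ _≡_ position
  position-injective {i} {j} e = lookup-injective xs-unique (begin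
    lookup xs i            ≡⟨ lookup-index (xs⊆ys (∈-lookup i)) ⟩
    lookup ys (position i) ≡⟨ cong (lookup ys) e ⟩
    lookup ys (position j) ≡⟨ lookup-index (xs⊆ys (∈-lookup j)) ⟨
    lookup xs j            ∎)
    where open ≡-Reasoning

lastOf : A → List A → A
lastOf x []       = x
lastOf _ (y ∷ ys) = lastOf y ys

lastOf-∈ : ∀ (x : A) xs → lastOf x xs ∈ x ∷ xs
lastOf-∈ x []       = here refl
lastOf-∈ _ (y ∷ ys) = there (lastOf-∈ y ys)

lastOf-∷ʳ : ∀ (x : A) xs → lastOf x (xs ∷ʳ y) ≡ y
lastOf-∷ʳ x []       = refl
lastOf-∷ʳ _ (z ∷ zs) = lastOf-∷ʳ z zs

last≡lastOf : ∀ (x : A) xs → L⁺.last (x ∷ xs) ≡ lastOf x xs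
last≡lastOf x xs with initLast xs
... | []       = refl
... | ys ∷ʳ′ y = sym (lastOf-∷ʳ x ys)

data Path {A : Set a} (g : A → A) : A → List A → Set a where
  []  : Path g x []
  _∷_ : g x ≡ y → Path g y ys → Path g x (y ∷ ys)

Path-∷ʳ : Path g x xs → g (lastOf x xs) ≡ y → Path g x (xs ∷ʳ y)
Path-∷ʳ []            next = next ∷ []
Path-∷ʳ (step ∷ path) next = step ∷ Path-∷ʳ path next

Path-∘ : (∀ {v} → v ∈ xs → k v ≡ v) → Path h x xs → Path (k ∘ h) x xs
Path-∘         k-fixes []            = []
Path-∘ {k = k} k-fixes (step ∷ path) =
  trans (cong k step) (k-fixes (here refl)) ∷ Path-∘ (k-fixes ∘ there) path

Path-step : Path g x xs → (u , v) ∈ toFP x xs → g u ≡ v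
Path-step (step ∷ _)  (here refl) = step
Path-step (_ ∷ path)  (there uv∈) = Path-step path uv∈

Path⇒All : (∀ {y} → P y → P (g y)) → P x → Path g x xs → All P (x ∷ xs)
Path⇒All _        px []            = px ∷ []
Path⇒All P-closed px (refl ∷ path) = px ∷ Path⇒All P-closed (P-closed px) path

Path⇒lastOf : (∀ {y} → P y → P (g y)) → Path g x xs → y ∈ x ∷ xs → P y → P (lastOf x xs)
Path⇒lastOf _                    []            (here refl) py = py
Path⇒lastOf {P = P} P-closed (refl ∷ path) (here refl) py =
  Path⇒lastOf {P = P} P-closed path (here refl) (P-closed py)
Path⇒lastOf P-closed             (_ ∷ path)    (there y∈)  py = Path⇒lastOf P-closed path y∈ py

Path-successor : Path g x xs → y ∈ x ∷ xs → y ≡ lastOf x xs ⊎ g y ∈ xs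
Path-successor []         (here refl) = inj₁ refl
Path-successor (refl ∷ _) (here refl) = inj₂ (here refl)
Path-successor (_ ∷ path) (there y∈)  = Sum.map₂ there (Path-successor path y∈)

Path-lastOf-successor-∉ : Injective _≡_ _≡_ g → Unique (x ∷ xs) → Path g x xs → g (lastOf x xs) ∉ xs
Path-lastOf-successor-∉ {xs = y ∷ ys} g-injective (x∉ ∷ _) (gx≡y ∷ _) (here closes) =
  All.lookup x∉ (lastOf-∈ y ys) (sym (g-injective (trans closes (sym gx≡y))))
Path-lastOf-successor-∉ g-injective (_ ∷ unique) (_ ∷ path) (there later) =
  Path-lastOf-successor-∉ g-injective unique path later

toFP-≢ : Unique (x ∷ xs) → (u , v) ∈ toFP x xs → u ≢ v
toFP-≢ {xs = _ ∷ _} (x∉ ∷ _)     (here refl) = All.lookup x∉ (here refl)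
toFP-≢ {xs = _ ∷ _} (_ ∷ unique) (there uv∈) = toFP-≢ unique uv∈

data IsCycle {A : Set a} (g : A → A) : List⁺ A → Set a where
  mkCycle : Unique (x ∷ xs) → Path g x xs → g (lastOf x xs) ≡ x → IsCycle g (x ∷ xs)

IsCycle-closed : IsCycle g cyc → y ∈ L⁺.toList cyc → g y ∈ L⁺.toList cyc
IsCycle-closed (mkCycle _ path closes) y∈ with Path-successor path y∈
... | inj₁ refl = here closes
... | inj₂ gy∈ = there gy∈

data DisjointCycles {A : Set a} (g : A → A) : List (List⁺ A) → Set a where
  []   : DisjointCycles g []
  cons : IsCycle g cyc → Disjoint (L⁺.toList cyc) (⋃ R) → DisjointCycles g R →
         DisjointCycles g (cyc ∷ R)

⋃-closed : DisjointCycles g R → y ∈ ⋃ R → g y ∈ ⋃ R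
⋃-closed (cons {cyc = cyc} cycle-cyc _ rest) y∈ with ∈-++⁻ (L⁺.toList cyc) y∈
... | inj₁ y∈cyc  = ∈-++⁺ˡ (IsCycle-closed cycle-cyc y∈cyc)
... | inj₂ y∈rest = ∈-++⁺ʳ (L⁺.toList cyc) (⋃-closed rest y∈rest)

toFP*-step : DisjointCycles g R → (u , v) ∈ toFP* R → g u ≡ v × u ≢ v
toFP*-step (cons {cyc = x ∷ xs} (mkCycle unique path _) _ rest) uv∈ with ∈-++⁻ (toFP x xs) uv∈
... | inj₁ uv∈cyc  = Path-step path uv∈cyc , toFP-≢ unique uv∈cyc
... | inj₂ uv∈rest = toFP*-step rest uv∈rest

toFP*-⊆supp : Injective _≡_ _≡_ g → DisjointCycles g R → (u , v) ∈ toFP* R →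
              u ∈supp g × v ∈supp g
toFP*-⊆supp g-injective disjoint uv∈ with toFP*-step disjoint uv∈
... | gu≡v , u≢v = (λ gu≡u → u≢v (trans (sym gu≡u) gu≡v))
                 , (λ gv≡v → u≢v (g-injective (trans gu≡v (sym gv≡v))))

module _ {A : Set a} (_≟_ : DecidableEquality A) where

  open import Data.List.Membership.DecPropositional _≟_ using (_∈?_)

  ⟦_⟧ : List (A × A) → A → A
  ⟦_⟧ = fromFP _≟_

  swap-left : ∀ x y → swap _≟_ x y x ≡ y
  swap-left x y with x ≟ x
  ... | yes _   = refl
  ... | no x≢x = contradiction refl x≢x

  swap-right : ∀ x y → swap _≟_ x y y ≡ x
  swap-right x y with y ≟ x
  ... | yes y≡x = y≡x
  ... | no _ with y ≟ y
  ...   | yes _   = refl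
  ...   | no y≢y = contradiction refl y≢y

  swap-fixes : z ≢ x → z ≢ y → swap _≟_ x y z ≡ z
  swap-fixes {z = z} {x = x} {y = y} z≢x z≢y with z ≟ x
  ... | yes z≡x = contradiction z≡x z≢x
  ... | no _ with z ≟ y
  ...   | yes z≡y = contradiction z≡y z≢y
  ...   | no _     = refl

  swap-involutive : ∀ x y z → swap _≟_ x y (swap _≟_ x y z) ≡ z
  swap-involutive x y z with z ≟ x
  ... | yes z≡x = trans (swap-right x y) (sym z≡x)
  ... | no z≢x with z ≟ y
  ...   | yes z≡y = trans (swap-left x y) (sym z≡y)
  ...   | no z≢y  = swap-fixes z≢x z≢y

  swap-injective : ∀ x y → Injective _≡_ _≡_ (swap _≟_ x y)
  swap-injective x y {u} {v} e = begin
    u                             ≡⟨ swap-involutive x y u ⟨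
    swap _≟_ x y (swap _≟_ x y u) ≡⟨ cong (swap _≟_ x y) e ⟩
    swap _≟_ x y (swap _≟_ x y v) ≡⟨ swap-involutive x y v ⟩
    v                             ∎
    where open ≡-Reasoning

  fromFP-++ : ∀ ps qs z → ⟦ ps ++ qs ⟧ z ≡ ⟦ ps ⟧ (⟦ qs ⟧ z)
  fromFP-++ []             qs z = refl
  fromFP-++ ((x , y) ∷ ps) qs z = cong (swap _≟_ x y) (fromFP-++ ps qs z)

  fromFP-injective : ∀ ps → Injective _≡_ _≡_ ⟦ ps ⟧
  fromFP-injective []             e = e
  fromFP-injective ((x , y) ∷ ps) e = fromFP-injective ps (swap-injective x y e)

  fromFP-toFP-∉ : z ∉ x ∷ xs → ⟦ toFP x xs ⟧ z ≡ z
  fromFP-toFP-∉ {xs = []} _ = refl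
  fromFP-toFP-∉ {z = z} {x = x} {xs = y ∷ ys} z∉ = begin
    swap _≟_ x y (⟦ toFP y ys ⟧ z) ≡⟨ cong (swap _≟_ x y) (fromFP-toFP-∉ (z∉ ∘ there)) ⟩
    swap _≟_ x y z                 ≡⟨ swap-fixes (z∉ ∘ here) (z∉ ∘ there ∘ here) ⟩
    z                              ∎
    where open ≡-Reasoning

  -- Generalising over h lets the induction absorb the leading transposition (x y) into h.
  fromFP-toFP-cycle : Unique (x ∷ xs) → Path h x xs → h (lastOf x xs) ≡ x →
                      z ∈ x ∷ xs → ⟦ toFP x xs ⟧ z ≡ h z
  fromFP-toFP-cycle _ [] closes (here refl) = sym closes
  fromFP-toFP-cycle {x = x} {xs = y ∷ ys} {h = h} (x∉ ∷ _) (hx≡y ∷ _) _ (here refl) = begin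
    swap _≟_ x y (⟦ toFP y ys ⟧ x) ≡⟨ cong (swap _≟_ x y) (fromFP-toFP-∉ (λ x∈ → All.lookup x∉ x∈ refl)) ⟩
    swap _≟_ x y x                 ≡⟨ swap-left x y ⟩
    y                              ≡⟨ hx≡y ⟨
    h x                            ∎
    where open ≡-Reasoning
  fromFP-toFP-cycle {x = x} {xs = y ∷ ys} {h = h} {z = z}
                    (x∉ ∷ unique@(y∉ ∷ _)) (_ ∷ path) closes (there z∈) = begin
    swap _≟_ x y (⟦ toFP y ys ⟧ z)    ≡⟨ cong (swap _≟_ x y) (fromFP-toFP-cycle unique path′ closes′ z∈) ⟩
    swap _≟_ x y (swap _≟_ x y (h z)) ≡⟨ swap-involutive x y (h z) ⟩
    h z                               ∎
    where
    open ≡-Reasoning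
    path′ : Path (swap _≟_ x y ∘ h) y ys
    path′ = Path-∘ (λ v∈ → swap-fixes (λ v≡x → All.lookup x∉ (there v∈) (sym v≡x))
                                      (λ v≡y → All.lookup y∉ v∈ (sym v≡y))) path
    closes′ : swap _≟_ x y (h (lastOf y ys)) ≡ y
    closes′ = trans (cong (swap _≟_ x y) closes) (swap-left x y)

  fromFP-toFP*-∉ : z ∉ ⋃ R → ⟦ toFP* R ⟧ z ≡ z
  fromFP-toFP*-∉ {R = []} _ = refl
  fromFP-toFP*-∉ {z = z} {R = (x ∷ xs) ∷ R} z∉ = begin
    ⟦ toFP x xs ++ toFP* R ⟧ z      ≡⟨ fromFP-++ (toFP x xs) (toFP* R) z ⟩
    ⟦ toFP x xs ⟧ (⟦ toFP* R ⟧ z) ≡⟨ cong ⟦ toFP x xs ⟧ (fromFP-toFP*-∉ {R = R} (z∉ ∘ ∈-++⁺ʳ (x ∷ xs))) ⟩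
    ⟦ toFP x xs ⟧ z                 ≡⟨ fromFP-toFP-∉ {xs = xs} (z∉ ∘ ∈-++⁺ˡ) ⟩
    z                               ∎
    where open ≡-Reasoning

  fromFP-toFP*-∈ : DisjointCycles g R → z ∈ ⋃ R → ⟦ toFP* R ⟧ z ≡ g z
  fromFP-toFP*-∈ {g = g} {z = z}
                 (cons {cyc = x ∷ xs} {R = R} (mkCycle unique path closes) disjoint rest) z∈
    with ∈-++⁻ (x ∷ xs) z∈
  ... | inj₁ z∈cyc = begin
    ⟦ toFP x xs ++ toFP* R ⟧ z      ≡⟨ fromFP-++ (toFP x xs) (toFP* R) z ⟩
    ⟦ toFP x xs ⟧ (⟦ toFP* R ⟧ z) ≡⟨ cong ⟦ toFP x xs ⟧ (fromFP-toFP*-∉ {R = R} (λ z∈R → disjoint (z∈cyc , z∈R))) ⟩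
    ⟦ toFP x xs ⟧ z                 ≡⟨ fromFP-toFP-cycle unique path closes z∈cyc ⟩
    g z                             ∎
    where open ≡-Reasoning
  ... | inj₂ z∈R = begin
    ⟦ toFP x xs ++ toFP* R ⟧ z      ≡⟨ fromFP-++ (toFP x xs) (toFP* R) z ⟩
    ⟦ toFP x xs ⟧ (⟦ toFP* R ⟧ z) ≡⟨ cong ⟦ toFP x xs ⟧ (fromFP-toFP*-∈ rest z∈R) ⟩
    ⟦ toFP x xs ⟧ (g z)             ≡⟨ fromFP-toFP-∉ (λ gz∈cyc → disjoint (gz∈cyc , ⋃-closed rest z∈R)) ⟩
    g z                             ∎
    where open ≡-Reasoning

  fromFP-toFP*-≗ : DisjointCycles g R → (∀ {z} → z ∈supp g → z ∈ ⋃ R) →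
                   ∀ z → ⟦ toFP* R ⟧ z ≡ g z
  fromFP-toFP*-≗ {g = g} {R = R} disjoint covers z with z ∈? ⋃ R
  ... | yes z∈R = fromFP-toFP*-∈ disjoint z∈R
  ... | no z∉R  = trans (fromFP-toFP*-∉ {R = R} z∉R) (sym (decidable-stable (g z ≟ z) (z∉R ∘ covers)))

  cycles-⊇ : ∀ {n} xs → ⋃ R ⊆ ⋃ (cycles _≟_ g n xs R)
  cycles-⊇ [] z∈ = z∈
  cycles-⊇ {R = R} (x ∷ xs) z∈ with any? (x ≟_) (⋃ R)
  ... | yes _ = cycles-⊇ xs z∈
  ... | no _  = cycles-⊇ xs (∈-++⁺ʳ (x ∷ _) z∈)

  cycles-covers : ∀ {n} xs → xs ⊆ ⋃ (cycles _≟_ g n xs R)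
  cycles-covers {R = R} (x ∷ xs) (here refl) with any? (x ≟_) (⋃ R)
  ... | yes x∈R = cycles-⊇ xs x∈R
  ... | no _    = cycles-⊇ xs (here refl)
  cycles-covers {R = R} (x ∷ xs) (there z∈) with any? (x ≟_) (⋃ R)
  ... | yes _ = cycles-covers xs z∈
  ... | no _  = cycles-covers xs z∈

  module _ {g : A → A} (g-injective : Injective _≡_ _≡_ g) where

    supp-closed : x ∈supp g → g x ∈supp g
    supp-closed x∈supp ggx≡gx = x∈supp (g-injective ggx≡gx)

    cycle-grows : x ∈supp g → ∀ m → let ρ = L⁺.toList (cycle _≟_ g m x) in
                  Unique (x ∷ ρ) × Path g x ρ × (g (lastOf x ρ) ≡ x ⊎ length ρ ≡ suc m)
    cycle-grows x∈supp zero = ((λ x≡gx → x∈supp (sym x≡gx)) ∷ []) ∷ [] ∷ [] , refl ∷ [] , inj₂ refl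
    cycle-grows {x = x} x∈supp (suc m) with cycle _≟_ g m x | cycle-grows x∈supp m
    ... | r ∷ rs | unique , path , closed-or-long with g (L⁺.last (r ∷ rs)) ≟ x
    ...   | yes closes = unique , path , inj₁ (trans (cong g (sym (last≡lastOf r rs))) closes)
    ...   | no ¬closes =
      Unique-∷ʳ unique next∉ , Path-∷ʳ path (cong g (sym (last≡lastOf r rs))) , inj₂ (grows closed-or-long)
      where
      next∉ : g (L⁺.last (r ∷ rs)) ∉ x ∷ r ∷ rs
      next∉ (here next≡x) = ¬closes next≡x
      next∉ (there next∈) = Path-lastOf-successor-∉ g-injective unique path
        (subst (_∈ r ∷ rs) (cong g (last≡lastOf r rs)) next∈)
      grows : g (lastOf r rs) ≡ x ⊎ length (r ∷ rs) ≡ suc m →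
              length ((r ∷ rs) ∷ʳ g (L⁺.last (r ∷ rs))) ≡ suc (suc m)
      grows (inj₁ closes) = contradiction (trans (cong g (last≡lastOf r rs)) closes) ¬closes
      grows (inj₂ long)   = trans (length-∷ʳ (r ∷ rs)) (cong suc long)

    module _ {ats : List A} (supp⊆ats : ∀ {z} → z ∈supp g → z ∈ ats) where

      -- Otherwise ρ would consist of 1 + |ats| distinct points of supp g.
      cycle-isCycle : x ∈supp g → IsCycle g (x ∷ L⁺.toList (cycle _≟_ g (length ats) x))
      cycle-isCycle {x = x} x∈supp with cycle-grows x∈supp (length ats)
      ... | unique , path , inj₁ closes = mkCycle unique path closes
      ... | _ ∷ ρ-unique , path , inj₂ long with Path⇒All supp-closed x∈supp path
      ...   | _ ∷ ρ⊆supp = contradiction (subst (_≤ length ats) long ρ-short) 1+n≰n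
        where
        ρ-short : length (L⁺.toList (cycle _≟_ g (length ats) x)) ≤ length ats
        ρ-short = Unique⇒length≤ ρ-unique (supp⊆ats ∘ All.lookup ρ⊆supp)

      cycles-disjoint : ∀ xs → (∀ {z} → z ∈ xs → z ∈supp g) → DisjointCycles g R →
                        DisjointCycles g (cycles _≟_ g (length ats) xs R)
      cycles-disjoint [] _ disjoint = disjoint
      cycles-disjoint {R = R} (x ∷ xs) xs⊆supp disjoint with any? (x ≟_) (⋃ R)
      ... | yes _   = cycles-disjoint xs (xs⊆supp ∘ there) disjoint
      ... | no x∉R = cycles-disjoint xs (xs⊆supp ∘ there) (cons orbit orbit-disjoint disjoint)
        where
        orbit : IsCycle g (x ∷ L⁺.toList (cycle _≟_ g (length ats) x))
        orbit = cycle-isCycle (xs⊆supp (here refl))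
        -- ⋃ R is closed under g, so an orbit meeting it would carry x into it.
        orbit-disjoint : Disjoint (x ∷ L⁺.toList (cycle _≟_ g (length ats) x)) (⋃ R)
        orbit-disjoint (z∈orbit , z∈R) with orbit
        ... | mkCycle _ path closes = x∉R (subst (_∈ ⋃ R) closes
          (⋃-closed disjoint (Path⇒lastOf (⋃-closed disjoint) path z∈orbit z∈R)))

corollary1 : ∀ {a : Level} {A : Set a} (_≟_ : DecidableEquality A)
    (p : List (A × A)) (ats : List A) →
    Unique ats →
    (∀ x → (x ∈ ats) ⇔ (x ∈supp fromFP _≟_ p)) →
    let g = fromFP _≟_ p
        R = cycles _≟_ g (length ats) ats []
    in ((∀ x → fromFP _≟_ (toFP* R) x ≡ fromFP _≟_ p x)
       × (∀ x y → (x , y) ∈ toFP* R →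
            (x ∈supp fromFP _≟_ (toFP* R)) × (y ∈supp fromFP _≟_ (toFP* R))))
corollary1 {A = A} _≟_ p ats _ ats⇔supp = agrees , λ _ _ xy∈ →
  Product.map (∈supp-resp-≗ agrees) (∈supp-resp-≗ agrees) (toFP*-⊆supp π-injective orbits-disjoint xy∈)
  where
  π : A → A
  π = fromFP _≟_ p
  orbits : List (List⁺ A)
  orbits = cycles _≟_ π (length ats) ats []
  π-injective : Injective _≡_ _≡_ π
  π-injective = fromFP-injective _≟_ p
  supp⊆ats : ∀ {z} → z ∈supp π → z ∈ ats
  supp⊆ats = Equivalence.from (ats⇔supp _)
  orbits-disjoint : DisjointCycles π orbits
  orbits-disjoint = cycles-disjoint _≟_ π-injective supp⊆ats ats (Equivalence.to (ats⇔supp _)) []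
  agrees : ∀ z → fromFP _≟_ (toFP* orbits) z ≡ π z
  agrees = fromFP-toFP*-≗ _≟_ orbits-disjoint (cycles-covers _≟_ ats ∘ supp⊆ats)
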